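{- Let $B$ and $T$ be disjoint finite sets with a bijection $\sigma:T\to B$, let $A$ be a $B\times T$ matrix over $GF(2)$ that is zero-diagonal, i.e. $A[\sigma(t),t]=0$ for all $t\in T$, and let $E=\begin{pmatrix} I & A\end{pmatrix}$ be the $B\times(B\cup T)$ matrix whose $B$-columns form the identity matrix. Let $\Omega=\{\{\sigma(t),t\}\mid t\in T\}$, so that $B$ and $T$ are transversals of $\Omega$, and let $M$ be the binary matroid on $B\cup T$ represented by $E$. Then $(M,\Omega)$ is a $2$-sheltering matroid if and only if $A$ is symmetric, i.e. $A[\sigma(s),t]=A[\sigma(t),s]$ for all $s,t\in T$.
   Context: A sheltering matroid is a pair $(M,\Omega)$ where $M$ is a matroid on a finite set $U$ and $\Omega$ a partition of $U$ such that for any subset $I$ independent in $M$ with $|I\cap\omega|\le1$ for all $\omega\in\Omega$, and any two distinct elements $x,y$ of a class $\omega$ with $\omega\cap I=\emptyset$, $I\cup\{x\}$ or $I\cup\{y\}$ is independent in $M$. It is a $2$-sheltering matroid if every class of $\Omega$ has exactly two elements. A transversal of $\Omega$ is a set meeting every class in exactly one element. -}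

module Defs where

open import Data.Bool using (Bool; true; false; _∧_; _∨_; _xor_)
open import Data.Nat using (ℕ; zero; suc)
open import Data.Fin using (Fin; zero; suc; _≟_)
open import Data.Fin.Properties using () renaming (_≟_ to _≟F_)
open import Data.Sum using (_⊎_; inj₁; inj₂)
open import Data.Sum.Properties using (≡-dec)
open import Data.Product using (Σ; _×_; _,_; ∃)
open import Relation.Binary.PropositionalEquality using (_≡_; _≢_)
open import Relation.Binary.Definitions using (DecidableEquality)
open import Relation.Nullary.Decidable using (⌊_⌋)
open import Function.Bundles using (_↔_; Inverse)

-- Subsets of a ground set U are characteristic functions U → Bool.

⊕Fin : ∀ n → (Fin n → Bool) → Bool
⊕Fin zero    f = false
⊕Fin (suc n) f = f zero xor ⊕Fin n (λ i → f (suc i))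

⊕U : ∀ n → (Fin n ⊎ Fin n → Bool) → Bool
⊕U n f = ⊕Fin n (λ i → f (inj₁ i)) xor ⊕Fin n (λ i → f (inj₂ i))

LinIndep : ∀ n → (col : Fin n ⊎ Fin n → Fin n → Bool) → (Fin n ⊎ Fin n → Bool) → Set
LinIndep n col I =
  (c : Fin n ⊎ Fin n → Bool) →
  (∀ u → c u ≡ true → I u ≡ true) →
  (∀ i → ⊕U n (λ u → c u ∧ col u i) ≡ false) →
  ∀ u → c u ≡ false

insert : {U : Set} → DecidableEquality U → U → (U → Bool) → (U → Bool)
insert _≟U_ x I z = I z ∨ ⌊ z ≟U x ⌋

-- Sheltering matroid: matroid given by its independence predicate 'Ind',
-- partition Ω given by the class map 'cls' (two elements are in the same
-- class iff they have the same image).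
Sheltering : {U C : Set} → DecidableEquality U → ((U → Bool) → Set) → (U → C) → Set
Sheltering {U} _≟U_ Ind cls =
  (I : U → Bool) → Ind I →
  (∀ x y → I x ≡ true → I y ≡ true → cls x ≡ cls y → x ≡ y) →   -- |I ∩ ω| ≤ 1
  (x y : U) → cls x ≡ cls y → x ≢ y →                            -- x ≠ y in a class ω
  (∀ z → cls z ≡ cls x → I z ≡ false) →                           -- ω ∩ I = ∅
  Ind (insert _≟U_ x I) ⊎ Ind (insert _≟U_ y I)

ClassesOfSizeTwo : {U C : Set} → (U → C) → Set
ClassesOfSizeTwo {U} {C} cls =
  (c : C) → Σ U λ x → Σ U λ y →
    x ≢ y × cls x ≡ c × cls y ≡ c × (∀ z → cls z ≡ c → z ≡ x ⊎ z ≡ y)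

TwoSheltering : {U C : Set} → DecidableEquality U → ((U → Bool) → Set) → (U → C) → Set
TwoSheltering _≟U_ Ind cls = Sheltering _≟U_ Ind cls × ClassesOfSizeTwo cls

-- The concrete setting: B = inj₁ (Fin n), T = inj₂ (Fin n), σ : T → B a bijection.
_≟U_ : ∀ {n} → DecidableEquality (Fin n ⊎ Fin n)
_≟U_ = ≡-dec _≟F_ _≟F_

-- Columns of E = (I A), rows indexed by B; A is a B × T matrix.
colE : ∀ n → (A : Fin n → Fin n → Bool) → Fin n ⊎ Fin n → Fin n → Bool
colE n A (inj₁ b) i = ⌊ i ≟F b ⌋
colE n A (inj₂ t) i = A i t

-- Class map for Ω = {{σ(t), t}} : classes indexed by t ∈ T.
clsΩ : ∀ n → (σ : Fin n ↔ Fin n) → Fin n ⊎ Fin n → Fin n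
clsΩ n σ (inj₁ b) = Inverse.from σ b
clsΩ n σ (inj₂ t) = t

module Submission where

-- Every class of Ω has two elements, so the theorem is:
-- (M, Ω) is sheltering iff A is σ-symmetric.
--
-- Plan of the file.
--   * GF(2) sums: ⊕Fin is the summation of the ring (Bool, xor, ∧), so the
--     library's theory of finite sums applies (Fubini, distributivity).
--   * Binary matroids: subsets of U are decidable by exhaustive search, hence an
--     independent I either stays independent after adding x, or some cycle of
--     I ∪ {x} passes through x.
--   * The representation (I A): the B-part of a cycle c is A applied to its
--     T-part, and every t ∈ T has a fundamental cycle {t} ∪ {b | A b t = 1}.
--   * Symmetric ⇒ sheltering: if both σ t and t closed cycles c₁, c₂ over I, the
--     symmetric pairing ⟨c₁_T, c₂_B⟩ = ⟨c₂_T, c₁_B⟩ would be 0 on one side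
--     (I meets each class once) and 1 on the other (only the class of t counts).
--   * Sheltering ⇒ symmetric: if A (σ s) t = 1 but A (σ t) s = 0, the set
--     W = (B ∖ {σ s, σ t}) ∪ {t} is independent, yet adding σ s closes the
--     fundamental cycle of t and adding s closes that of s.

open import Defs
open import Algebra.Bundles using (CommutativeRing)
open import Data.Bool using (Bool; true; false; not; _∧_; _∨_; _xor_)
open import Data.Bool.Properties
  using (xor-∧-commutativeRing; xor-identityʳ; xor-same; ∧-zeroʳ; ∧-identityʳ; ∨-zeroʳ; ¬-not; T-≡)
  renaming (_≟_ to _≟B_)
open import Data.Nat using (ℕ; suc)
open import Data.Fin using (Fin)
open import Data.Fin.Properties using (all?; punchInᵢ≢i) renaming (_≟_ to _≟F_)
open import Data.Fin.Subset using (Subset)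
open import Data.Fin.Subset.Properties using (anySubset?)
open import Data.Vec using (lookup; tabulate)
open import Data.Vec.Properties using (lookup∘tabulate)
open import Data.Vec.Functional using (removeAt)
open import Data.Sum using (_⊎_; inj₁; inj₂; [_,_]; [_,_]′; swap)
open import Data.Sum.Properties using (inj₁-injective; inj₂-injective)
open import Data.Product using (_×_; _,_; ∃)
open import Data.Empty using (⊥; ⊥-elim)
open import Function using (_∘_)
open import Function.Bundles using (_↔_; _⇔_; Inverse; Equivalence; mk⇔)
open import Relation.Nullary using (¬_; Dec; yes; no; contradiction)
open import Relation.Nullary.Decidable
  using (⌊_⌋; map′; _×-dec_; _→-dec_; dec-true; dec-false; isYes≗does; toWitness)
open import Relation.Binary.PropositionalEquality
  using (_≡_; _≢_; _≗_; refl; sym; trans; cong; cong₂; subst; module ≡-Reasoning)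

open CommutativeRing xor-∧-commutativeRing using (semiring; *-commutativeSemigroup)
open import Algebra.Properties.Semiring.Sum semiring
  using (sum; sum-cong-≗; sum-replicate-zero; sum-remove; ∑-comm; *-distribˡ-sum)
open import Algebra.Properties.CommutativeSemigroup *-commutativeSemigroup using (x∙yz≈y∙xz)

open ≡-Reasoning

U : ℕ → Set
U n = Fin n ⊎ Fin n

witness : ∀ {P : Set} (P? : Dec P) → ⌊ P? ⌋ ≡ true → P
witness P? h = toWitness (Equivalence.from T-≡ h)

⌊⌋-yes : ∀ {P : Set} (P? : Dec P) → P → ⌊ P? ⌋ ≡ true
⌊⌋-yes P? p = trans (isYes≗does P?) (dec-true P? p)

⌊⌋-no : ∀ {P : Set} (P? : Dec P) → ¬ P → ⌊ P? ⌋ ≡ false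
⌊⌋-no P? ¬p = trans (isYes≗does P?) (dec-false P? ¬p)

∧≡false : ∀ {a b} → (a ≡ true → b ≡ true → ⊥) → a ∧ b ≡ false
∧≡false {false} _ = refl
∧≡false {true} {false} _ = refl
∧≡false {true} {true} both = ⊥-elim (both refl refl)

true≢false : true ≡ false → ⊥
true≢false ()

xor≡false⇒≡ : ∀ a b → a xor b ≡ false → a ≡ b
xor≡false⇒≡ false false _ = refl
xor≡false⇒≡ true true _ = refl

≡-from-true⇔true : ∀ {a b} → (a ≡ true → b ≡ true) → (b ≡ true → a ≡ true) → a ≡ b
≡-from-true⇔true {false} {false} _ _ = refl
≡-from-true⇔true {true} {true} _ _ = refl
≡-from-true⇔true {false} {true} _ b⇒a = b⇒a refl
≡-from-true⇔true {true} {false} a⇒b _ = sym (a⇒b refl)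

⊕Fin≡sum : ∀ n (f : Fin n → Bool) → ⊕Fin n f ≡ sum f
⊕Fin≡sum ℕ.zero f = refl
⊕Fin≡sum (suc n) f = cong (f Fin.zero xor_) (⊕Fin≡sum n (f ∘ Fin.suc))

sum-vanishing : ∀ {n} (f : Fin n → Bool) → (∀ i → f i ≡ false) → sum f ≡ false
sum-vanishing {n} f f≡0 = trans (sum-cong-≗ f≡0) (sum-replicate-zero n)

sum-single : ∀ {n} (f : Fin n → Bool) k → (∀ i → i ≢ k → f i ≡ false) → sum f ≡ f k
sum-single {suc n} f k f≡0 = begin
  sum f                       ≡⟨ sum-remove f ⟩
  f k xor sum (removeAt f k)  ≡⟨ cong (f k xor_) (sum-vanishing _ (λ j → f≡0 _ (punchInᵢ≢i k j))) ⟩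
  f k xor false               ≡⟨ xor-identityʳ (f k) ⟩
  f k                         ∎

⊕U-cong : ∀ n {f g : U n → Bool} → f ≗ g → ⊕U n f ≡ ⊕U n g
⊕U-cong n {f} {g} f≗g = cong₂ _xor_ (half (f≗g ∘ inj₁)) (half (f≗g ∘ inj₂))
  where
  half : ∀ {f' g' : Fin n → Bool} → f' ≗ g' → ⊕Fin n f' ≡ ⊕Fin n g'
  half {f'} {g'} e = trans (⊕Fin≡sum n f') (trans (sum-cong-≗ e) (sym (⊕Fin≡sum n g')))

Extensional : ∀ {n} → ((U n → Bool) → Set) → Set
Extensional {n} Q = ∀ {c c' : U n → Bool} → c ≗ c' → Q c → Q c'

-- A decidable, extensional property of subsets of B ⊎ T has a decidable
-- existential: encode a subset by its two halves as bit vectors.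
search : ∀ {n} {Q : (U n → Bool) → Set} → (∀ c → Dec (Q c)) → Extensional Q → Dec (∃ Q)
search {n} {Q} Q? ext =
  map′ decoded encoded (anySubset? λ p → anySubset? λ q → Q? (decode p q))
  where
  decode : Subset n → Subset n → U n → Bool
  decode p q = [ lookup p , lookup q ]′

  decoded : ∃ (λ p → ∃ λ q → Q (decode p q)) → ∃ Q
  decoded (p , q , h) = decode p q , h

  encoded : ∃ Q → ∃ (λ p → ∃ λ q → Q (decode p q))
  encoded (c , h) = tabulate (c ∘ inj₁) , tabulate (c ∘ inj₂) , ext roundtrip h
    where
    roundtrip : c ≗ decode (tabulate (c ∘ inj₁)) (tabulate (c ∘ inj₂))
    roundtrip (inj₁ b) = sym (lookup∘tabulate (c ∘ inj₁) b)
    roundtrip (inj₂ t) = sym (lookup∘tabulate (c ∘ inj₂) t)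

all⊎? : ∀ {n} {P : U n → Set} → (∀ u → Dec (P u)) → Dec (∀ u → P u)
all⊎? P? = map′ (λ (onB , onT) → [ onB , onT ]) (λ all → all ∘ inj₁ , all ∘ inj₂)
                (all? (P? ∘ inj₁) ×-dec all? (P? ∘ inj₂))

insert-new : ∀ {n} (x : U n) (J : U n → Bool) {u} → u ≡ x → insert _≟U_ x J u ≡ true
insert-new x J {u} u≡x = trans (cong (J u ∨_) (⌊⌋-yes (u ≟U x) u≡x)) (∨-zeroʳ (J u))

insert-old : ∀ {n} (x : U n) (J : U n → Bool) {u} → J u ≡ true → insert _≟U_ x J u ≡ true
insert-old x J u∈J = cong (_∨ _) u∈J

insert-inv : ∀ {n} (x : U n) (J : U n → Bool) {u} → insert _≟U_ x J u ≡ true → u ≢ x → J u ≡ true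
insert-inv x J {u} u∈J+x u≢x with J u
... | true = refl
... | false = contradiction (witness (u ≟U x) u∈J+x) u≢x

module BinaryMatroid {n : ℕ} (col : U n → Fin n → Bool) where

  Independent : (U n → Bool) → Set
  Independent = LinIndep n col

  Supported : (J c : U n → Bool) → Set
  Supported J c = ∀ u → c u ≡ true → J u ≡ true

  IsCycle : (U n → Bool) → Set
  IsCycle c = ∀ i → ⊕U n (λ u → c u ∧ col u i) ≡ false

  cycle⇒dependent : ∀ {J c} u → Supported J c → IsCycle c → c u ≡ true → ¬ Independent J
  cycle⇒dependent {c = c} u sup cyc u∈c ind = true≢false (trans (sym u∈c) (ind c sup cyc u))

  CycleThrough : (J : U n → Bool) → U n → (U n → Bool) → Set
  CycleThrough J x c = Supported (insert _≟U_ x J) c × IsCycle c × c x ≡ true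

  cycleThrough? : ∀ J x c → Dec (CycleThrough J x c)
  cycleThrough? J x c =
    all⊎? (λ u → c u ≟B true →-dec insert _≟U_ x J u ≟B true)
    ×-dec all? (λ i → ⊕U n (λ u → c u ∧ col u i) ≟B false)
    ×-dec (c x ≟B true)

  cycleThrough-ext : ∀ J x → Extensional (CycleThrough J x)
  cycleThrough-ext J x c≗c' (sup , cyc , x∈c) =
    (λ u u∈c' → sup u (trans (c≗c' u) u∈c')) ,
    (λ i → trans (⊕U-cong n (λ u → cong (_∧ col u i) (sym (c≗c' u)))) (cyc i)) ,
    trans (sym (c≗c' x)) x∈c

  -- If no cycle of I ∪ {x} uses x, then every cycle of I ∪ {x} lies in I.
  extend : ∀ {I} x → Independent I → ¬ ∃ (CycleThrough I x) → Independent (insert _≟U_ x I)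
  extend {I} x ind ∄cyc c sup cyc with c x in x∈c
  ... | true = ⊥-elim (∄cyc (c , sup , cyc , x∈c))
  ... | false = ind c inI cyc
    where
    inI : Supported I c
    inI u u∈c = insert-inv x I (sup u u∈c) λ { refl → true≢false (trans (sym u∈c) x∈c) }

  augment : ∀ {I} x → Independent I → Independent (insert _≟U_ x I) ⊎ ∃ (CycleThrough I x)
  augment {I} x ind with search (cycleThrough? I x) (cycleThrough-ext I x)
  ... | yes cyc = inj₂ cyc
  ... | no ∄cyc = inj₁ (extend x ind ∄cyc)

module StandardRepresentation {n : ℕ} (A : Fin n → Fin n → Bool) where

  open BinaryMatroid (colE n A) public

  identity-block : ∀ (c : U n → Bool) i → ⊕Fin n (λ b → c (inj₁ b) ∧ ⌊ i ≟F b ⌋) ≡ c (inj₁ i)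
  identity-block c i = begin
    ⊕Fin n (λ b → c (inj₁ b) ∧ ⌊ i ≟F b ⌋)  ≡⟨ ⊕Fin≡sum n _ ⟩
    sum (λ b → c (inj₁ b) ∧ ⌊ i ≟F b ⌋)     ≡⟨ sum-single _ i off-diagonal ⟩
    c (inj₁ i) ∧ ⌊ i ≟F i ⌋                 ≡⟨ cong (c (inj₁ i) ∧_) (⌊⌋-yes (i ≟F i) refl) ⟩
    c (inj₁ i) ∧ true                       ≡⟨ ∧-identityʳ _ ⟩
    c (inj₁ i)                              ∎
    where
    off-diagonal : ∀ b → b ≢ i → c (inj₁ b) ∧ ⌊ i ≟F b ⌋ ≡ false
    off-diagonal b b≢i = trans (cong (c (inj₁ b) ∧_) (⌊⌋-no (i ≟F b) (b≢i ∘ sym))) (∧-zeroʳ _)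

  cycle-B-part : ∀ {c} → IsCycle c → ∀ i → sum (λ t → c (inj₂ t) ∧ A i t) ≡ c (inj₁ i)
  cycle-B-part {c} cyc i = begin
    sum (λ t → c (inj₂ t) ∧ A i t)     ≡⟨ ⊕Fin≡sum n _ ⟨
    ⊕Fin n (λ t → c (inj₂ t) ∧ A i t)  ≡⟨ xor≡false⇒≡ _ _ row-sum ⟨
    c (inj₁ i)                         ∎
    where
    row-sum : c (inj₁ i) xor ⊕Fin n (λ t → c (inj₂ t) ∧ A i t) ≡ false
    row-sum = trans (cong (_xor ⊕Fin n (λ t → c (inj₂ t) ∧ A i t)) (sym (identity-block c i))) (cyc i)

  fundamental : Fin n → U n → Bool
  fundamental k (inj₁ b) = A b k
  fundamental k (inj₂ t) = ⌊ t ≟F k ⌋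

  fundamental-isCycle : ∀ k → IsCycle (fundamental k)
  fundamental-isCycle k i = begin
    ⊕Fin n (λ b → A b k ∧ ⌊ i ≟F b ⌋) xor ⊕Fin n (λ t → ⌊ t ≟F k ⌋ ∧ A i t)
      ≡⟨ cong₂ _xor_ (identity-block (fundamental k) i) T-part ⟩
    A i k xor A i k
      ≡⟨ xor-same (A i k) ⟩
    false ∎
    where
    T-part : ⊕Fin n (λ t → ⌊ t ≟F k ⌋ ∧ A i t) ≡ A i k
    T-part = begin
      ⊕Fin n (λ t → ⌊ t ≟F k ⌋ ∧ A i t)  ≡⟨ ⊕Fin≡sum n _ ⟩
      sum (λ t → ⌊ t ≟F k ⌋ ∧ A i t)     ≡⟨ sum-single _ k off-k ⟩
      ⌊ k ≟F k ⌋ ∧ A i k                 ≡⟨ cong (_∧ A i k) (⌊⌋-yes (k ≟F k) refl) ⟩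
      A i k                              ∎
      where
      off-k : ∀ t → t ≢ k → ⌊ t ≟F k ⌋ ∧ A i t ≡ false
      off-k t t≢k = cong (_∧ A i t) (⌊⌋-no (t ≟F k) t≢k)

  fundamental-dependent : ∀ {J} k → J (inj₂ k) ≡ true →
    (∀ b → A b k ≡ true → J (inj₁ b) ≡ true) → ¬ Independent J
  fundamental-dependent {J} k k∈J column⊆J =
    cycle⇒dependent (inj₂ k) supported (fundamental-isCycle k) (⌊⌋-yes (k ≟F k) refl)
    where
    supported : Supported J (fundamental k)
    supported (inj₁ b) = column⊆J b
    supported (inj₂ t) t≡k with witness (t ≟F k) t≡k
    ... | refl = k∈J

module Omega (n : ℕ) (σ : Fin n ↔ Fin n) (A : Fin n → Fin n → Bool) where

  open StandardRepresentation A

  private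
    to : Fin n → Fin n
    to = Inverse.to σ

    from : Fin n → Fin n
    from = Inverse.from σ

    to∘from : ∀ b → to (from b) ≡ b
    to∘from = Inverse.strictlyInverseˡ σ

    from∘to : ∀ t → from (to t) ≡ t
    from∘to = Inverse.strictlyInverseʳ σ

    to-injective : ∀ {s t} → to s ≡ to t → s ≡ t
    to-injective {s} {t} e = trans (sym (from∘to s)) (trans (cong from e) (from∘to t))

    from-injective : ∀ {b b'} → from b ≡ from b' → b ≡ b'
    from-injective {b} {b'} e = trans (sym (to∘from b)) (trans (cong to e) (to∘from b'))

  cls : U n → Fin n
  cls = clsΩ n σ

  Symmetric : Set
  Symmetric = ∀ s t → A (to s) t ≡ A (to t) s

  classes-of-size-two : ClassesOfSizeTwo cls
  classes-of-size-two t = inj₁ (to t) , inj₂ t , (λ ()) , from∘to t , refl , members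
    where
    members : ∀ u → cls u ≡ t → u ≡ inj₁ (to t) ⊎ u ≡ inj₂ t
    members (inj₁ b) refl = inj₁ (cong inj₁ (sym (to∘from b)))
    members (inj₂ z) refl = inj₂ refl

  MeetsClassesOnce : (U n → Bool) → Set
  MeetsClassesOnce I = ∀ x y → I x ≡ true → I y ≡ true → cls x ≡ cls y → x ≡ y

  class-not-both : ∀ {I} → MeetsClassesOnce I →
    ∀ t → I (inj₁ (to t)) ≡ true → I (inj₂ t) ≡ true → ⊥
  class-not-both once t σt∈I t∈I with once (inj₁ (to t)) (inj₂ t) σt∈I t∈I (from∘to t)
  ... | ()

  -- For symmetric A the pairing ⟨c_T, c'_B⟩ = Σ_z c(z) c'(σ z) of two cycles is
  -- symmetric: with c_B = A c_T both sides are the bilinear form Σ c(z) A(σ z, z') c'(z').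
  cycle-pairing : Symmetric → ∀ {c c'} → IsCycle c → IsCycle c' →
    sum (λ z → c (inj₂ z) ∧ c' (inj₁ (to z))) ≡ sum (λ z → c' (inj₂ z) ∧ c (inj₁ (to z)))
  cycle-pairing symA {c} {c'} cyc cyc' = begin
    sum (λ z → v z ∧ c' (inj₁ (to z)))
      ≡⟨ sum-cong-≗ (λ z → cong (v z ∧_) (cycle-B-part {c'} cyc' (to z))) ⟨
    sum (λ z → v z ∧ sum (λ z' → w z' ∧ A (to z) z'))
      ≡⟨ sum-cong-≗ (λ z → *-distribˡ-sum (v z) (λ z' → w z' ∧ A (to z) z')) ⟩
    sum (λ z → sum (λ z' → v z ∧ (w z' ∧ A (to z) z')))
      ≡⟨ ∑-comm (λ z z' → v z ∧ (w z' ∧ A (to z) z')) ⟩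
    sum (λ z' → sum (λ z → v z ∧ (w z' ∧ A (to z) z')))
      ≡⟨ sum-cong-≗ (λ z' → sum-cong-≗ (λ z → exchange z z')) ⟩
    sum (λ z' → sum (λ z → w z' ∧ (v z ∧ A (to z') z)))
      ≡⟨ sum-cong-≗ (λ z' → *-distribˡ-sum (w z') (λ z → v z ∧ A (to z') z)) ⟨
    sum (λ z' → w z' ∧ sum (λ z → v z ∧ A (to z') z))
      ≡⟨ sum-cong-≗ (λ z' → cong (w z' ∧_) (cycle-B-part {c} cyc (to z'))) ⟩
    sum (λ z' → w z' ∧ c (inj₁ (to z'))) ∎
    where
    v w : Fin n → Bool
    v z = c (inj₂ z)
    w z = c' (inj₂ z)

    exchange : ∀ z z' → v z ∧ (w z' ∧ A (to z) z') ≡ w z' ∧ (v z ∧ A (to z') z)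
    exchange z z' = trans (x∙yz≈y∙xz (v z) (w z') _) (cong (λ a → w z' ∧ (v z ∧ a)) (symA z z'))

  -- For symmetric A, σ t and t cannot both close a cycle over I: the pairing of
  -- the two cycles is 0 one way round (I meets every class once) and 1 the other
  -- way (only the class of t contributes).
  no-two-cycles : Symmetric → ∀ {I} → MeetsClassesOnce I → ∀ t →
    ∃ (CycleThrough I (inj₁ (to t))) → ∃ (CycleThrough I (inj₂ t)) → ⊥
  no-two-cycles symA {I} once t (c₁ , sup₁ , cyc₁ , σt∈c₁) (c₂ , sup₂ , cyc₂ , t∈c₂) =
    true≢false (begin
      true                                                ≡⟨ pairing₂₁ ⟨
      sum (λ z → c₂ (inj₂ z) ∧ c₁ (inj₁ (to z)))         ≡⟨ cycle-pairing symA {c₁} {c₂} cyc₁ cyc₂ ⟨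
      sum (λ z → c₁ (inj₂ z) ∧ c₂ (inj₁ (to z)))         ≡⟨ pairing₁₂ ⟩
      false                                               ∎)
    where
    pairing₁₂ : sum (λ z → c₁ (inj₂ z) ∧ c₂ (inj₁ (to z))) ≡ false
    pairing₁₂ = sum-vanishing _ λ z → ∧≡false λ z∈c₁ σz∈c₂ → class-not-both once z
      (insert-inv (inj₂ t) I (sup₂ (inj₁ (to z)) σz∈c₂) λ ())
      (insert-inv (inj₁ (to t)) I (sup₁ (inj₂ z) z∈c₁) λ ())

    pairing₂₁ : sum (λ z → c₂ (inj₂ z) ∧ c₁ (inj₁ (to z))) ≡ true
    pairing₂₁ = trans (sum-single _ t off-t) (cong₂ _∧_ t∈c₂ σt∈c₁)
      where
      off-t : ∀ z → z ≢ t → c₂ (inj₂ z) ∧ c₁ (inj₁ (to z)) ≡ false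
      off-t z z≢t = ∧≡false λ z∈c₂ σz∈c₁ → class-not-both once z
        (insert-inv (inj₁ (to t)) I (sup₁ (inj₁ (to z)) σz∈c₁) (z≢t ∘ to-injective ∘ inj₁-injective))
        (insert-inv (inj₂ t) I (sup₂ (inj₂ z) z∈c₂) (z≢t ∘ inj₂-injective))

  one-of-class : Symmetric → ∀ {I} → Independent I → MeetsClassesOnce I → ∀ t →
    Independent (insert _≟U_ (inj₁ (to t)) I) ⊎ Independent (insert _≟U_ (inj₂ t) I)
  one-of-class symA ind once t with augment (inj₁ (to t)) ind | augment (inj₂ t) ind
  ... | inj₁ σt-extends | _ = inj₁ σt-extends
  ... | inj₂ _ | inj₁ t-extends = inj₂ t-extends
  ... | inj₂ cyc₁ | inj₂ cyc₂ = ⊥-elim (no-two-cycles symA once t cyc₁ cyc₂)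

  one-of-class-at : Symmetric → ∀ {I} → Independent I → MeetsClassesOnce I → ∀ b →
    Independent (insert _≟U_ (inj₁ b) I) ⊎ Independent (insert _≟U_ (inj₂ (from b)) I)
  one-of-class-at symA {I} ind once b =
    subst (λ b' → Independent (insert _≟U_ (inj₁ b') I) ⊎ Independent (insert _≟U_ (inj₂ (from b)) I))
          (to∘from b) (one-of-class symA ind once (from b))

  -- Two distinct elements of a class are b and σ⁻¹ b in some order.
  sheltering-if-symmetric : Symmetric → Sheltering _≟U_ Independent cls
  sheltering-if-symmetric symA I ind once (inj₁ b) (inj₁ b') same b≢b' _ =
    contradiction (cong inj₁ (from-injective same)) b≢b'
  sheltering-if-symmetric symA I ind once (inj₂ t) (inj₂ t') same t≢t' _ =
    contradiction (cong inj₂ same) t≢t'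
  sheltering-if-symmetric symA I ind once (inj₁ b) (inj₂ _) refl _ _ =
    one-of-class-at symA ind once b
  sheltering-if-symmetric symA I ind once (inj₂ _) (inj₁ b) refl _ _ =
    swap (one-of-class-at symA ind once b)

  module Asymmetry (diag : ∀ t → A (to t) t ≡ false) {s t : Fin n} (s≢t : s ≢ t)
                   (st≡1 : A (to s) t ≡ true) (ts≡0 : A (to t) s ≡ false) where

    W : U n → Bool
    W (inj₁ b) = not (⌊ b ≟F to s ⌋ ∨ ⌊ b ≟F to t ⌋)
    W (inj₂ z) = ⌊ z ≟F t ⌋

    W-B : ∀ b → b ≢ to s → b ≢ to t → W (inj₁ b) ≡ true
    W-B b b≢σs b≢σt =
      cong₂ (λ p q → not (p ∨ q)) (⌊⌋-no (b ≟F to s) b≢σs) (⌊⌋-no (b ≟F to t) b≢σt)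

    σs∉W : W (inj₁ (to s)) ≡ false
    σs∉W = cong (λ p → not (p ∨ ⌊ to s ≟F to t ⌋)) (⌊⌋-yes (to s ≟F to s) refl)

    σt∉W : W (inj₁ (to t)) ≡ false
    σt∉W = cong not (trans (cong (⌊ to t ≟F to s ⌋ ∨_) (⌊⌋-yes (to t ≟F to t) refl)) (∨-zeroʳ _))

    -- A cycle inside W is t plus column t of A, which contains σ s ∉ W; so it is empty.
    W-independent : Independent W
    W-independent c sup cyc = all-zero
      where
      T-part : ∀ z → z ≢ t → c (inj₂ z) ≡ false
      T-part z z≢t = ¬-not λ z∈c → z≢t (witness (z ≟F t) (sup _ z∈c))

      B-part : ∀ i → c (inj₁ i) ≡ c (inj₂ t) ∧ A i t
      B-part i = trans (sym (cycle-B-part {c} cyc i))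
                       (sum-single _ t λ z z≢t → cong (_∧ A i z) (T-part z z≢t))

      t∉c : c (inj₂ t) ≡ false
      t∉c = begin
        c (inj₂ t)                 ≡⟨ ∧-identityʳ _ ⟨
        c (inj₂ t) ∧ true          ≡⟨ cong (c (inj₂ t) ∧_) st≡1 ⟨
        c (inj₂ t) ∧ A (to s) t    ≡⟨ B-part (to s) ⟨
        c (inj₁ (to s))            ≡⟨ ¬-not (λ σs∈c → true≢false (trans (sym (sup _ σs∈c)) σs∉W)) ⟩
        false                      ∎

      all-zero : ∀ u → c u ≡ false
      all-zero (inj₁ i) = trans (B-part i) (cong (_∧ A i t) t∉c)
      all-zero (inj₂ z) with z ≟F t
      ... | yes refl = t∉c
      ... | no z≢t = T-part z z≢t

    -- The only element of W in the class of t is t itself, since σ t ∉ W.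
    not-class-t : ∀ b → W (inj₁ b) ≡ true → from b ≢ t
    not-class-t b b∈W from-b≡t =
      true≢false (trans (sym b∈W) (subst (λ b → W (inj₁ b) ≡ false) σt≡b σt∉W))
      where
      σt≡b : to t ≡ b
      σt≡b = trans (cong to (sym from-b≡t)) (to∘from b)

    -- W has one element in the class of t and one in every class {σ b', b'} with b' ∉ {s, t}.
    W-meets-once : MeetsClassesOnce W
    W-meets-once (inj₁ b) (inj₁ b') _ _ same = cong inj₁ (from-injective same)
    W-meets-once (inj₂ z) (inj₂ z') _ _ same = cong inj₂ same
    W-meets-once (inj₁ b) (inj₂ z) b∈W z∈W same =
      ⊥-elim (not-class-t b b∈W (trans same (witness (z ≟F t) z∈W)))
    W-meets-once (inj₂ z) (inj₁ b) z∈W b∈W same =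
      ⊥-elim (not-class-t b b∈W (trans (sym same) (witness (z ≟F t) z∈W)))

    W-avoids-s : ∀ u → cls u ≡ cls (inj₁ (to s)) → W u ≡ false
    W-avoids-s (inj₁ b) same = subst (λ b → W (inj₁ b) ≡ false) (sym (from-injective same)) σs∉W
    W-avoids-s (inj₂ z) same =
      ⌊⌋-no (z ≟F t) λ z≡t → s≢t (trans (sym (trans same (from∘to s))) z≡t)

    -- Adding σ s completes the fundamental cycle of t (A (σ t) t = 0 keeps σ t out of it).
    σs-dependent : ¬ Independent (insert _≟U_ (inj₁ (to s)) W)
    σs-dependent =
      fundamental-dependent t (insert-old (inj₁ (to s)) W {inj₂ t} (⌊⌋-yes (t ≟F t) refl)) column-t
      where
      column-t : ∀ b → A b t ≡ true → insert _≟U_ (inj₁ (to s)) W (inj₁ b) ≡ true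
      column-t b bt≡1 = by-cases (b ≟F to s)
        where
        by-cases : Dec (b ≡ to s) → insert _≟U_ (inj₁ (to s)) W (inj₁ b) ≡ true
        by-cases (yes b≡σs) = insert-new (inj₁ (to s)) W (cong inj₁ b≡σs)
        by-cases (no b≢σs) = insert-old (inj₁ (to s)) W {inj₁ b}
          (W-B b b≢σs λ { refl → true≢false (trans (sym bt≡1) (diag t)) })

    -- Adding s completes the fundamental cycle of s (A (σ s) s = A (σ t) s = 0).
    s-dependent : ¬ Independent (insert _≟U_ (inj₂ s) W)
    s-dependent = fundamental-dependent s (insert-new (inj₂ s) W refl) column-s
      where
      column-s : ∀ b → A b s ≡ true → insert _≟U_ (inj₂ s) W (inj₁ b) ≡ true
      column-s b bs≡1 = insert-old (inj₂ s) W {inj₁ b} (W-B b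
        (λ { refl → true≢false (trans (sym bs≡1) (diag s)) })
        (λ { refl → true≢false (trans (sym bs≡1) ts≡0) }))

    not-sheltering : ¬ Sheltering _≟U_ Independent cls
    not-sheltering sh =
      [ σs-dependent , s-dependent ]′
        (sh W W-independent W-meets-once (inj₁ (to s)) (inj₂ s) (from∘to s) (λ ()) W-avoids-s)

  mirrored : (∀ t → A (to t) t ≡ false) → Sheltering _≟U_ Independent cls →
    ∀ {s t} → s ≢ t → A (to s) t ≡ true → A (to t) s ≡ true
  mirrored diag sh s≢t st≡1 = ¬-not λ ts≡0 → Asymmetry.not-sheltering diag s≢t st≡1 ts≡0 sh

  symmetric-if-sheltering : (∀ t → A (to t) t ≡ false) → Sheltering _≟U_ Independent cls → Symmetric
  symmetric-if-sheltering diag sh s t with s ≟F t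
  ... | yes refl = refl
  ... | no s≢t = ≡-from-true⇔true (mirrored diag sh s≢t) (mirrored diag sh (s≢t ∘ sym))

lemma16 : (n : ℕ) (σ : Fin n ↔ Fin n) (A : Fin n → Fin n → Bool) →
    (∀ t → A (Inverse.to σ t) t ≡ false) →
    TwoSheltering _≟U_ (LinIndep n (colE n A)) (clsΩ n σ)
      ⇔ (∀ s t → A (Inverse.to σ s) t ≡ A (Inverse.to σ t) s)
lemma16 n σ A diag = mk⇔
  (λ (sheltering , _) → symmetric-if-sheltering diag sheltering)
  (λ symmetric → sheltering-if-symmetric symmetric , classes-of-size-two)
  where open Omega n σ A
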